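{- Let $\mathbf x=(x_1,\ldots,x_n)\in\{0,1\}^n$. Then there is exactly one $k\in\{0,\ldots,\lfloor n/2\rfloor\}$ such that the prefix $\mathbf x'=(x_1,\ldots,x_{n-k})$ belongs to $\binom{[n-k]}{k}$ or to $\binom{[n-k-1]}{k}_1$.
   Context: $\binom{[n-k]}{k}$ denotes the family of vectors $(x_1,\ldots,x_{n-k})\in\{0,1\}^{n-k}$ with $x_1+\cdots+x_{n-k}=k$. $\binom{[n-k-1]}{k}_1$ denotes the family of vectors $(x_1,\ldots,x_{n-k})\in\{0,1\}^{n-k}$ with $x_1+\cdots+x_{n-k-1}=k$ and $x_{n-k}=1$ (sums are ordinary integer sums). -}

module Defs where

open import Data.Bool using (Bool; true; false)
open import Data.Nat using (ℕ; zero; suc; _+_; _∸_)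
open import Data.List using (List; []; _∷_; _∷ʳ_; take)
open import Data.Vec using (Vec; toList)
open import Data.Product using (Σ; _×_)
open import Relation.Binary.PropositionalEquality using (_≡_)

weight : List Bool → ℕ
weight [] = 0
weight (true ∷ xs) = suc (weight xs)
weight (false ∷ xs) = weight xs

-- y ∈ binom([m]) k  where m = length y : entries sum to k
InBinom : ℕ → List Bool → Set
InBinom k ys = weight ys ≡ k

-- y ∈ binom([m-1]) k _1 : last entry is 1, first m-1 entries sum to k
InBinom₁ : ℕ → List Bool → Set
InBinom₁ k ys = Σ (List Bool) λ zs → (ys ≡ zs ∷ʳ true) × (weight zs ≡ k)

prefix : {n : ℕ} → ℕ → Vec Bool n → List Bool
prefix {n} k x = take (n ∸ k) (toList x)

-- Read a 0/1 word as a walk in which 0 is a step of length 1 and 1 a step of length 2.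
-- Since its length plus its weight is the sum of its step lengths, a prefix of length
-- n - k lies in binom([n-k], k) exactly when its walk lands on n, and in binom([n-k-1], k)_1
-- exactly when its last step is a 2 jumping over n.  As the walk along the prefixes of x
-- is strictly increasing with steps 1 or 2, the point n is landed on or jumped over
-- exactly once; the bound k ≤ ⌊n/2⌋ holds because the weight is at most the length.
module Submission where

open import Defs
open import Data.Bool using (Bool; true; false)
open import Data.Empty using (⊥)
open import Data.Unit using (⊤; tt)
open import Data.Nat using (ℕ; zero; suc; _+_; _∸_; _⊓_; _≤_; z≤n; s≤s; ⌊_/2⌋)
open import Data.Nat.Properties
open import Data.List using (List; []; _∷_; _∷ʳ_; take; length)
open import Data.List.Properties using (length-take; length-++-≤ˡ)
open import Data.Vec using (Vec; toList)
open import Data.Vec.Properties using (length-toList)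
open import Data.Product using (Σ; ∃; _×_; _,_)
open import Data.Sum using (_⊎_; inj₁; inj₂)
open import Relation.Nullary using (contradiction)
open import Relation.Binary.PropositionalEquality

Fits : ℕ → List Bool → Set
Fits k ys = InBinom k ys ⊎ InBinom₁ k ys

stepSum : List Bool → ℕ
stepSum []           = 0
stepSum (false ∷ ys) = suc (stepSum ys)
stepSum (true ∷ ys)  = suc (suc (stepSum ys))

-- The walk of ys lands on t, or its last step is a 2 that jumps over t.
Reaches : List Bool → ℕ → Set
Reaches []           zero          = ⊤
Reaches []           (suc t)       = ⊥
Reaches (_ ∷ _)      zero          = ⊥
Reaches (false ∷ ys) (suc t)       = Reaches ys t
Reaches (true ∷ ys)  (suc zero)    = ys ≡ []
Reaches (true ∷ ys)  (suc (suc t)) = Reaches ys t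

weight≤length : ∀ ys → weight ys ≤ length ys
weight≤length []           = z≤n
weight≤length (true ∷ ys)  = s≤s (weight≤length ys)
weight≤length (false ∷ ys) = m≤n⇒m≤1+n (weight≤length ys)

length≤stepSum : ∀ ys → length ys ≤ stepSum ys
length≤stepSum []           = z≤n
length≤stepSum (false ∷ ys) = s≤s (length≤stepSum ys)
length≤stepSum (true ∷ ys)  = s≤s (m≤n⇒m≤1+n (length≤stepSum ys))

Fits⇒≤length : ∀ {k} ys → Fits k ys → k ≤ length ys
Fits⇒≤length ys (inj₁ refl)              = weight≤length ys
Fits⇒≤length _  (inj₂ (zs , refl , refl)) = ≤-trans (weight≤length zs) (length-++-≤ˡ zs)

Fits-∷ : ∀ b {k ys} → Fits k ys → Fits (weight (b ∷ []) + k) (b ∷ ys)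
Fits-∷ true  (inj₁ refl)               = inj₁ refl
Fits-∷ false (inj₁ refl)               = inj₁ refl
Fits-∷ true  (inj₂ (zs , refl , refl)) = inj₂ (true ∷ zs , refl , refl)
Fits-∷ false (inj₂ (zs , refl , refl)) = inj₂ (false ∷ zs , refl , refl)

Reaches⇒length≤ : ∀ ys {t} → Reaches ys t → length ys ≤ t
Reaches⇒length≤ []                          _    = z≤n
Reaches⇒length≤ (false ∷ ys) {suc t}       r    = s≤s (Reaches⇒length≤ ys r)
Reaches⇒length≤ (true ∷ ys)  {suc zero}    refl = s≤s z≤n
Reaches⇒length≤ (true ∷ ys)  {suc (suc t)} r    = s≤s (m≤n⇒m≤1+n (Reaches⇒length≤ ys r))

reaches-exact : ∀ ys → Reaches ys (length ys + weight ys)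
reaches-exact []           = tt
reaches-exact (false ∷ ys) = reaches-exact ys
reaches-exact (true ∷ ys)  rewrite +-suc (length ys) (weight ys) = reaches-exact ys

reaches-jump : ∀ zs → Reaches (zs ∷ʳ true) (length (zs ∷ʳ true) + weight zs)
reaches-jump []           = refl
reaches-jump (false ∷ zs) = reaches-jump zs
reaches-jump (true ∷ zs)  rewrite +-suc (length (zs ∷ʳ true)) (weight zs) = reaches-jump zs

Fits⇒Reaches : ∀ {k} ys → Fits k ys → Reaches ys (length ys + k)
Fits⇒Reaches ys (inj₁ refl)               = reaches-exact ys
Fits⇒Reaches _  (inj₂ (zs , refl , refl)) = reaches-jump zs

Reaches⇒Fits : ∀ {k} ys → Reaches ys (length ys + k) → Fits k ys
Reaches⇒Fits {zero}  []           _ = inj₁ refl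
Reaches⇒Fits         (false ∷ ys) r = Fits-∷ false (Reaches⇒Fits ys r)
Reaches⇒Fits {suc k} (true ∷ ys)  r
  rewrite +-suc (length ys) k       = Fits-∷ true (Reaches⇒Fits ys r)
Reaches⇒Fits {zero}  (true ∷ [])  _ = inj₂ ([] , refl , refl)
Reaches⇒Fits {zero}  (true ∷ y ∷ ys) r
  rewrite +-identityʳ (length ys)   = contradiction (Reaches⇒length≤ (y ∷ ys) r) (n≮n (length ys))

reaches-take : ∀ xs t → t ≤ stepSum xs → ∃ λ m → m ≤ length xs × Reaches (take m xs) t
reaches-take xs           zero          _         = 0 , z≤n , tt
reaches-take (false ∷ xs) (suc t)       (s≤s t≤)  with reaches-take xs t t≤
... | m , m≤ , r = suc m , s≤s m≤ , r
reaches-take (true ∷ xs)  (suc zero)    _         = 1 , s≤s z≤n , refl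
reaches-take (true ∷ xs)  (suc (suc t)) (s≤s (s≤s t≤)) with reaches-take xs t t≤
... | m , m≤ , r = suc m , s≤s m≤ , r

take≡[]⇒≡0 : ∀ {A : Set} {m} (xs : List A) → m ≤ length xs → take m xs ≡ [] → m ≡ 0
take≡[]⇒≡0 {m = zero}  _ _ _ = refl
take≡[]⇒≡0 {m = suc m} (x ∷ xs) _ ()

reaches-take-unique : ∀ xs t {m m′} → m ≤ length xs → m′ ≤ length xs →
  Reaches (take m xs) t → Reaches (take m′ xs) t → m ≡ m′
reaches-take-unique _ _ {zero} {zero} _ _ _ _ = refl
reaches-take-unique (_ ∷ xs) zero    {zero}  {suc _} _ _ _  ()
reaches-take-unique (_ ∷ xs) zero    {suc _}         _ _ () _
reaches-take-unique (_ ∷ xs) (suc _) {zero}  {suc _} _ _ () _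
reaches-take-unique (_ ∷ xs) (suc _) {suc _} {zero}  _ _ _  ()
reaches-take-unique (false ∷ xs) (suc t) {suc _} {suc _} (s≤s m≤) (s≤s m′≤) r r′ =
  cong suc (reaches-take-unique xs t m≤ m′≤ r r′)
reaches-take-unique (true ∷ xs) (suc zero) {suc _} {suc _} (s≤s m≤) (s≤s m′≤) r r′ =
  cong suc (trans (take≡[]⇒≡0 xs m≤ r) (sym (take≡[]⇒≡0 xs m′≤ r′)))
reaches-take-unique (true ∷ xs) (suc (suc t)) {suc _} {suc _} (s≤s m≤) (s≤s m′≤) r r′ =
  cong suc (reaches-take-unique xs t m≤ m′≤ r r′)

module _ {n : ℕ} (x : Vec Bool n) where

  length-prefix+ : ∀ {k} → k ≤ n → length (prefix k x) + k ≡ n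
  length-prefix+ {k} k≤n = begin
    length (take (n ∸ k) (toList x)) + k ≡⟨ cong (_+ k) (length-take (n ∸ k) (toList x)) ⟩
    (n ∸ k) ⊓ length (toList x) + k      ≡⟨ cong (λ l → (n ∸ k) ⊓ l + k) (length-toList x) ⟩
    (n ∸ k) ⊓ n + k                      ≡⟨ cong (_+ k) (m≤n⇒m⊓n≡m (m∸n≤m n k)) ⟩
    n ∸ k + k                            ≡⟨ m∸n+n≡m k≤n ⟩
    n                                    ∎
    where open ≡-Reasoning

  prefix-Fits⇒Reaches : ∀ {k} → k ≤ n → Fits k (prefix k x) → Reaches (prefix k x) n
  prefix-Fits⇒Reaches {k} k≤n h =
    subst (Reaches (prefix k x)) (length-prefix+ k≤n) (Fits⇒Reaches (prefix k x) h)

  prefix-Reaches⇒Fits : ∀ {k} → k ≤ n → Reaches (prefix k x) n → Fits k (prefix k x)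
  prefix-Reaches⇒Fits {k} k≤n r =
    Reaches⇒Fits (prefix k x) (subst (Reaches (prefix k x)) (sym (length-prefix+ k≤n)) r)

  prefix-Fits⇒≤⌊n/2⌋ : ∀ {k} → k ≤ n → Fits k (prefix k x) → k ≤ ⌊ n /2⌋
  prefix-Fits⇒≤⌊n/2⌋ {k} k≤n h = subst (_≤ ⌊ n /2⌋) (sym (n≡⌊n+n/2⌋ k)) (⌊n/2⌋-mono k+k≤n)
    where
    k+k≤n : k + k ≤ n
    k+k≤n = subst (k + k ≤_) (length-prefix+ k≤n) (+-monoˡ-≤ k (Fits⇒≤length _ h))

  length-toList≤ : ∀ {m} → m ≤ n → m ≤ length (toList x)
  length-toList≤ m≤n = subst (_ ≤_) (sym (length-toList x)) m≤n

  prefix-reaches : ∃ λ k → k ≤ n × Reaches (prefix k x) n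
  prefix-reaches with reaches-take (toList x) n (≤-trans (length-toList≤ ≤-refl) (length≤stepSum _))
  ... | m , m≤ , r = n ∸ m , m∸n≤m n m ,
    subst (λ j → Reaches (take j (toList x)) n) (sym (m∸[m∸n]≡n m≤n)) r
    where
    m≤n : m ≤ n
    m≤n = subst (_ ≤_) (length-toList x) m≤

  prefix-reaches-unique : ∀ {k k′} → k ≤ n → k′ ≤ n →
    Reaches (prefix k x) n → Reaches (prefix k′ x) n → k ≡ k′
  prefix-reaches-unique {k} {k′} k≤n k′≤n r r′ = ∸-cancelˡ-≡ k≤n k′≤n
    (reaches-take-unique (toList x) n (length-toList≤ (m∸n≤m n k)) (length-toList≤ (m∸n≤m n k′)) r r′)

lemma3 : (n : ℕ) (x : Vec Bool n) →
    Σ ℕ (λ k → (k ≤ ⌊ n /2⌋ × (InBinom k (prefix k x) ⊎ InBinom₁ k (prefix k x)))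
      × ((k′ : ℕ) → k′ ≤ ⌊ n /2⌋ → (InBinom k′ (prefix k′ x) ⊎ InBinom₁ k′ (prefix k′ x)) → k′ ≡ k))
lemma3 n x with prefix-reaches x
... | k , k≤n , r = k , (prefix-Fits⇒≤⌊n/2⌋ x k≤n fits , fits) , unique
  where
  fits : Fits k (prefix k x)
  fits = prefix-Reaches⇒Fits x k≤n r
  unique : (k′ : ℕ) → k′ ≤ ⌊ n /2⌋ → Fits k′ (prefix k′ x) → k′ ≡ k
  unique k′ k′≤ h = prefix-reaches-unique x k′≤n k≤n (prefix-Fits⇒Reaches x k′≤n h) r
    where
    k′≤n : k′ ≤ n
    k′≤n = ≤-trans k′≤ (⌊n/2⌋≤n n)
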